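{- Let $k$ and $n$ be positive integers. Then, in the polynomial ring $\mathbb{Z}[x_1,\dots,x_n]$, \[h_{k,n-k+1}(x) = \sum_{i=1}^{k} (-1)^{i+1} e_{i,n}(x)\, h_{k-i,n-k+1}(x).\]
   Context: For integers $j \ge 0$ and $m$, the elementary symmetric polynomial is $e_{j,m}(x)=\sum_{1\le i_1<\dots<i_j\le m} x_{i_1}\cdots x_{i_j}$ (so $e_{0,m}=1$ for $m\ge 0$ and $e_{j,m}=0$ whenever $m<j$), and the complete homogeneous symmetric polynomial is $h_{j,m}(x)=\sum_{1\le i_1\le\dots\le i_j\le m} x_{i_1}\cdots x_{i_j}$, with the conventions $h_{0,m}=1$ for every integer $m$ and $h_{j,m}=0$ when $j>0$ and $m\le 0$. -}

module Defs where

open import Level using (Level)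
open import Data.Bool using (Bool; true; false; _∧_; if_then_else_)
open import Data.Nat using (ℕ; zero; suc; _<ᵇ_; _≤ᵇ_)
open import Data.Integer using (ℤ; +_; -[1+_])
open import Data.List using (List; []; _∷_; [_]; map; concatMap; upTo; foldr)
open import Algebra.Bundles using (CommutativeRing)

-- all length-j lists with entries in {0,…,m-1}  (index i stands for x_{i+1})
tuples : ℕ → ℕ → List (List ℕ)
tuples zero    m = [ [] ]
tuples (suc j) m = concatMap (λ i → map (i ∷_) (tuples j m)) (upTo m)

strictInc : List ℕ → Bool
strictInc []           = true
strictInc (a ∷ [])     = true
strictInc (a ∷ b ∷ l)  = (a <ᵇ b) ∧ strictInc (b ∷ l)

weakInc : List ℕ → Bool
weakInc []           = true
weakInc (a ∷ [])     = true
weakInc (a ∷ b ∷ l)  = (a ≤ᵇ b) ∧ weakInc (b ∷ l)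

keep : {A : Set} → (A → Bool) → List A → List A
keep p []      = []
keep p (a ∷ l) = if p a then a ∷ keep p l else keep p l

module Sym {c ℓ : Level} (R : CommutativeRing c ℓ) where
  open CommutativeRing R public

  Σ : List Carrier → Carrier
  Σ = foldr _+_ 0#

  Π : List Carrier → Carrier
  Π = foldr _*_ 1#

  mono : (ℕ → Carrier) → List ℕ → Carrier
  mono x is = Π (map x is)

  e : (ℕ → Carrier) → ℕ → ℕ → Carrier
  e x j m = Σ (map (mono x) (keep strictInc (tuples j m)))

  hₙ : (ℕ → Carrier) → ℕ → ℕ → Carrier
  hₙ x j m = Σ (map (mono x) (keep weakInc (tuples j m)))

  h : (ℕ → Carrier) → ℕ → ℤ → Carrier
  h x j       (+ m)     = hₙ x j m
  h x zero    -[1+ m ]  = 1#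
  h x (suc j) -[1+ m ]  = 0#

  sgn : ℕ → Carrier
  sgn zero    = 1#
  sgn (suc i) = (- 1#) * sgn i

  Σ₁ : ℕ → (ℕ → Carrier) → Carrier
  Σ₁ zero    f = 0#
  Σ₁ (suc k) f = Σ₁ k f + f (suc k)

-- Writing E_n(t) = Σ_i (-1)^i e_{i,n} t^i = Π_{j≤n} (1 - x_j t) and H_m(t) = Σ_j h_{j,m} t^j
-- = Π_{j≤m} 1/(1 - x_j t), the product E_{m+L}(t) H_m(t) = Π_{m<j≤m+L} (1 - x_j t) is a
-- polynomial of degree L.  Hence its coefficient of t^k vanishes for L < k, and for
-- m = max(n - k + 1, 0), n = m + L, this vanishing coefficient is exactly the difference of
-- the two sides.  The factorisation is proved one variable at a time: removing x_1 from both sums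
-- multiplies E by 1/(1 - x_1 t) and H by (1 - x_1 t), which leaves the product unchanged.
module Submission where

open import Defs
open import Level using (Level)
open import Data.Bool using (Bool; true; false; _∧_)
open import Data.Nat as ℕ using (ℕ; zero; suc; _∸_; _≥_; _<_; _≤_; _<ᵇ_; _≤ᵇ_; _⊓_; s≤s)
open import Data.Nat.Properties as ℕₚ using (≤-refl; m≤n⇒m≤1+n; +-∸-assoc; n∸n≡0; m⊓n+n∸m≡n; m⊓n≤m)
open import Data.Integer as ℤ using (+_; _⊖_)
open import Data.Integer.Properties using ([+m]-[+n]≡m⊖n; distribˡ-⊖-+-pos; [1+m]⊖[1+n]≡m⊖n)
open import Data.List using (List; []; _∷_; [_]; map; upTo; applyUpTo; concatMap; _++_)
open import Function using (_∘_)
open import Algebra.Bundles using (CommutativeRing)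
open import Relation.Binary.PropositionalEquality as P using (_≡_)

n-[1+k]+1≡n⊖k : ∀ n k → (+ n ℤ.- + suc k) ℤ.+ + 1 ≡ n ⊖ k
n-[1+k]+1≡n⊖k n k = begin
  (+ n ℤ.- + suc k) ℤ.+ + 1  ≡⟨ P.cong (ℤ._+ + 1) ([+m]-[+n]≡m⊖n n (suc k)) ⟩
  n ⊖ suc k ℤ.+ + 1          ≡⟨ distribˡ-⊖-+-pos 1 n (suc k) ⟩
  n ℕ.+ 1 ⊖ suc k            ≡⟨ P.cong (_⊖ suc k) (ℕₚ.+-comm n 1) ⟩
  suc n ⊖ suc k              ≡⟨ [1+m]⊖[1+n]≡m⊖n n k ⟩
  n ⊖ k                      ∎
  where open P.≡-Reasoning

module SymmetricFunctions {c ℓ : Level} (R : CommutativeRing c ℓ) where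
  open Sym R
  open import Relation.Binary.Reasoning.Setoid setoid
  open import Algebra.Solver.Ring.NaturalCoefficients.Default commutativeSemiring using (solve; _:=_; _:+_; _:*_)
  open import Algebra.Properties.Ring ring using (-1*x≈-x)
  open import Algebra.Properties.Group +-group using (inverseˡ-unique)

  _when_ : Carrier → Bool → Carrier
  x when true  = x
  x when false = 0#

  when-cong : ∀ b {x y} → x ≈ y → x when b ≈ y when b
  when-cong true  x≈y = x≈y
  when-cong false x≈y = refl

  when-∧ : ∀ b c x → x when (b ∧ c) ≈ (x when c) when b
  when-∧ true  c x = refl
  when-∧ false c x = refl

  *-when : ∀ b x y → (x * y) when b ≈ x * (y when b)
  *-when true  x y = refl
  *-when false x y = sym (zeroʳ x)

  Σ-map-cong : ∀ {A : Set} {f g : A → Carrier} (l : List A) → (∀ a → f a ≈ g a) → Σ (map f l) ≈ Σ (map g l)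
  Σ-map-cong []      f≈g = refl
  Σ-map-cong (a ∷ l) f≈g = +-cong (f≈g a) (Σ-map-cong l f≈g)

  Σ-map-++ : ∀ {A : Set} (f : A → Carrier) (l₁ l₂ : List A) → Σ (map f (l₁ ++ l₂)) ≈ Σ (map f l₁) + Σ (map f l₂)
  Σ-map-++ f []       l₂ = sym (+-identityˡ _)
  Σ-map-++ f (a ∷ l₁) l₂ = trans (+-congˡ (Σ-map-++ f l₁ l₂)) (sym (+-assoc _ _ _))

  Σ-map-map : ∀ {A B : Set} (f : B → Carrier) (g : A → B) (l : List A) → Σ (map f (map g l)) ≈ Σ (map (f ∘ g) l)
  Σ-map-map f g []      = refl
  Σ-map-map f g (a ∷ l) = +-congˡ (Σ-map-map f g l)

  Σ-map-keep : ∀ {A : Set} (f : A → Carrier) (p : A → Bool) (l : List A) →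
    Σ (map f (keep p l)) ≈ Σ (map (λ a → f a when p a) l)
  Σ-map-keep f p []      = refl
  Σ-map-keep f p (a ∷ l) with p a
  ... | true  = +-congˡ (Σ-map-keep f p l)
  ... | false = trans (Σ-map-keep f p l) (sym (+-identityˡ _))

  Σ-map-*ˡ : ∀ {A : Set} (x : Carrier) (f : A → Carrier) (l : List A) → Σ (map (λ a → x * f a) l) ≈ x * Σ (map f l)
  Σ-map-*ˡ x f []      = sym (zeroʳ x)
  Σ-map-*ˡ x f (a ∷ l) = trans (+-congˡ (Σ-map-*ˡ x f l)) (sym (distribˡ x _ _))

  Σ-map-when : ∀ {A : Set} b (f : A → Carrier) (l : List A) → Σ (map (λ a → f a when b) l) ≈ Σ (map f l) when b
  Σ-map-when true  f l       = refl
  Σ-map-when false f []      = refl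
  Σ-map-when false f (a ∷ l) = trans (+-identityˡ _) (Σ-map-when false f l)

  Σ< : ℕ → (ℕ → Carrier) → Carrier
  Σ< zero    f = 0#
  Σ< (suc m) f = f 0 + Σ< m (f ∘ suc)

  Σ<-cong : ∀ m {f g : ℕ → Carrier} → (∀ i → f i ≈ g i) → Σ< m f ≈ Σ< m g
  Σ<-cong zero    f≈g = refl
  Σ<-cong (suc m) f≈g = +-cong (f≈g 0) (Σ<-cong m (f≈g ∘ suc))

  Σ-map-applyUpTo : ∀ (f : ℕ → Carrier) g m → Σ (map f (applyUpTo g m)) ≈ Σ< m (f ∘ g)
  Σ-map-applyUpTo f g zero    = refl
  Σ-map-applyUpTo f g (suc m) = +-congˡ (Σ-map-applyUpTo f (g ∘ suc) m)

  Σtuples : ℕ → ℕ → (List ℕ → Carrier) → Carrier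
  Σtuples j m f = Σ (map f (tuples j m))

  Σtuples-suc : ∀ j m f → Σtuples (suc j) m f ≈ Σ< m (λ i → Σtuples j m (f ∘ (i ∷_)))
  Σtuples-suc j m f = trans (Σ-concat (upTo m)) (Σ-map-applyUpTo _ (λ i → i) m)
    where
    Σ-concat : ∀ l → Σ (map f (concatMap (λ i → map (i ∷_) (tuples j m)) l))
                   ≈ Σ (map (λ i → Σtuples j m (f ∘ (i ∷_))) l)
    Σ-concat []      = refl
    Σ-concat (i ∷ l) = trans (Σ-map-++ f (map (i ∷_) (tuples j m)) _)
                             (+-cong (Σ-map-map f (i ∷_) (tuples j m)) (Σ-concat l))

  Σtuples-*-when : ∀ j m b x f → Σtuples j m (λ t → (x * f t) when b) ≈ (x * Σtuples j m f) when b
  Σtuples-*-when j m b x f =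
    trans (Σ-map-when b _ (tuples j m)) (when-cong b (Σ-map-*ˡ x f (tuples j m)))

  module ChainSums
    (r : ℕ → ℕ → Bool) (inc : List ℕ → Bool)
    (inc-[_] : ∀ a → inc [ a ] ≡ true)
    (inc-∷∷ : ∀ a b t → inc (a ∷ b ∷ t) ≡ r a b ∧ inc (b ∷ t))
    (r-suc-suc : ∀ a b → r (suc a) (suc b) ≡ r a b)
    (r-suc-zero : ∀ a → r (suc a) 0 ≡ false)
    where

    chainSum : (ℕ → Carrier) → ℕ → ℕ → Carrier
    chainSum x j m = Σ (map (mono x) (keep inc (tuples j m)))

    chainSumAbove : (ℕ → Carrier) → ℕ → ℕ → ℕ → Carrier
    chainSumAbove x j a m = Σtuples j m (λ t → mono x t when inc (a ∷ t))

    chainSum-suc : ∀ x j m → chainSum x (suc j) m ≈ Σ< m (λ i → x i * chainSumAbove x j i m)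
    chainSum-suc x j m = begin
      chainSum x (suc j) m
        ≈⟨ Σ-map-keep (mono x) inc (tuples (suc j) m) ⟩
      Σtuples (suc j) m (λ t → mono x t when inc t)
        ≈⟨ Σtuples-suc j m _ ⟩
      Σ< m (λ i → Σtuples j m (λ t → (x i * mono x t) when inc (i ∷ t)))
        ≈⟨ Σ<-cong m (λ i → trans (Σ-map-cong (tuples j m) (λ t → *-when (inc (i ∷ t)) (x i) (mono x t)))
                                  (Σ-map-*ˡ (x i) _ (tuples j m))) ⟩
      Σ< m (λ i → x i * chainSumAbove x j i m) ∎

    chainSumAbove-suc : ∀ x j a m →
      chainSumAbove x (suc j) a m ≈ Σ< m (λ i → (x i * chainSumAbove x j i m) when r a i)
    chainSumAbove-suc x j a m = trans (Σtuples-suc j m _) (Σ<-cong m (λ i → begin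
      Σtuples j m (λ t → (x i * mono x t) when inc (a ∷ i ∷ t))
        ≈⟨ Σ-map-cong (tuples j m) (λ t → begin
             (x i * mono x t) when inc (a ∷ i ∷ t)
               ≡⟨ P.cong ((x i * mono x t) when_) (inc-∷∷ a i t) ⟩
             (x i * mono x t) when (r a i ∧ inc (i ∷ t))
               ≈⟨ when-∧ (r a i) _ _ ⟩
             ((x i * mono x t) when inc (i ∷ t)) when r a i
               ≈⟨ when-cong (r a i) (*-when (inc (i ∷ t)) (x i) (mono x t)) ⟩
             (x i * (mono x t when inc (i ∷ t))) when r a i ∎) ⟩
      Σtuples j m (λ t → (x i * (mono x t when inc (i ∷ t))) when r a i)
        ≈⟨ Σtuples-*-when j m (r a i) (x i) _ ⟩
      (x i * chainSumAbove x j i m) when r a i ∎))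

    chainSumAbove-shift : ∀ x j a m → chainSumAbove x j (suc a) (suc m) ≈ chainSumAbove (x ∘ suc) j a m
    chainSumAbove-shift x zero a m rewrite inc-[ suc a ] | inc-[ a ] = refl
    chainSumAbove-shift x (suc j) a m = begin
      chainSumAbove x (suc j) (suc a) (suc m)
        ≈⟨ chainSumAbove-suc x j (suc a) (suc m) ⟩
      (x 0 * chainSumAbove x j 0 (suc m)) when r (suc a) 0
        + Σ< m (λ i → (x (suc i) * chainSumAbove x j (suc i) (suc m)) when r (suc a) (suc i))
        ≈⟨ +-cong (reflexive (P.cong ((x 0 * chainSumAbove x j 0 (suc m)) when_) (r-suc-zero a)))
                  (Σ<-cong m (λ i → reflexive (P.cong ((x (suc i) * chainSumAbove x j (suc i) (suc m)) when_)
                                                      (r-suc-suc a i)))) ⟩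
      0# + Σ< m (λ i → (x (suc i) * chainSumAbove x j (suc i) (suc m)) when r a i)
        ≈⟨ +-identityˡ _ ⟩
      Σ< m (λ i → (x (suc i) * chainSumAbove x j (suc i) (suc m)) when r a i)
        ≈⟨ Σ<-cong m (λ i → when-cong (r a i) (*-congˡ (chainSumAbove-shift x j i m))) ⟩
      Σ< m (λ i → (x (suc i) * chainSumAbove (x ∘ suc) j i m) when r a i)
        ≈⟨ chainSumAbove-suc (x ∘ suc) j a m ⟨
      chainSumAbove (x ∘ suc) (suc j) a m ∎

    chainSum-peel : ∀ x j m →
      chainSum x (suc j) (suc m) ≈ x 0 * chainSumAbove x j 0 (suc m) + chainSum (x ∘ suc) (suc j) m
    chainSum-peel x j m = trans (chainSum-suc x j (suc m)) (+-congˡ (begin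
      Σ< m (λ i → x (suc i) * chainSumAbove x j (suc i) (suc m))
        ≈⟨ Σ<-cong m (λ i → *-congˡ (chainSumAbove-shift x j i m)) ⟩
      Σ< m (λ i → x (suc i) * chainSumAbove (x ∘ suc) j i m)
        ≈⟨ chainSum-suc (x ∘ suc) j m ⟨
      chainSum (x ∘ suc) (suc j) m ∎))

  ≤ᵇ-suc-suc : ∀ a b → (suc a ≤ᵇ suc b) ≡ (a ≤ᵇ b)
  ≤ᵇ-suc-suc zero    b = P.refl
  ≤ᵇ-suc-suc (suc a) b = P.refl

  module Elementary = ChainSums _<ᵇ_ strictInc (λ _ → P.refl) (λ _ _ _ → P.refl) (λ _ _ → P.refl) (λ _ → P.refl)
  module Complete   = ChainSums _≤ᵇ_ weakInc (λ _ → P.refl) (λ _ _ _ → P.refl) ≤ᵇ-suc-suc (λ _ → P.refl)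

  e-peel : ∀ x j m → e x (suc j) (suc m) ≈ x 0 * e (x ∘ suc) j m + e (x ∘ suc) (suc j) m
  e-peel x j m = trans (Elementary.chainSum-peel x j m) (+-congʳ (*-congˡ (above-0 x j)))
    where
    open Elementary
    above-0 : ∀ x j → chainSumAbove x j 0 (suc m) ≈ e (x ∘ suc) j m
    above-0 x zero    = refl
    above-0 x (suc j) = begin
      chainSumAbove x (suc j) 0 (suc m)
        ≈⟨ chainSumAbove-suc x j 0 (suc m) ⟩
      0# + Σ< m (λ i → x (suc i) * chainSumAbove x j (suc i) (suc m))
        ≈⟨ +-identityˡ _ ⟩
      Σ< m (λ i → x (suc i) * chainSumAbove x j (suc i) (suc m))
        ≈⟨ Σ<-cong m (λ i → *-congˡ (chainSumAbove-shift x j i m)) ⟩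
      Σ< m (λ i → x (suc i) * chainSumAbove (x ∘ suc) j i m)
        ≈⟨ chainSum-suc (x ∘ suc) j m ⟨
      e (x ∘ suc) (suc j) m ∎

  h-peel : ∀ x j m → hₙ x (suc j) (suc m) ≈ x 0 * hₙ x j (suc m) + hₙ (x ∘ suc) (suc j) m
  h-peel x j m = trans (Complete.chainSum-peel x j m) (+-congʳ (*-congˡ (above-0 x j)))
    where
    open Complete
    above-0 : ∀ x j → chainSumAbove x j 0 (suc m) ≈ hₙ x j (suc m)
    above-0 x zero    = refl
    above-0 x (suc j) = trans (chainSumAbove-suc x j 0 (suc m)) (sym (chainSum-suc x j (suc m)))

  e-vanish : ∀ x n k → n < k → e x k n ≈ 0#
  e-vanish x zero    (suc k) n<k       = refl
  e-vanish x (suc n) (suc k) (s≤s n<k) = begin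
    e x (suc k) (suc n)                            ≈⟨ e-peel x k n ⟩
    x 0 * e (x ∘ suc) k n + e (x ∘ suc) (suc k) n  ≈⟨ +-cong (*-congˡ (e-vanish (x ∘ suc) n k n<k))
                                                            (e-vanish (x ∘ suc) n (suc k) (m≤n⇒m≤1+n n<k)) ⟩
    x 0 * 0# + 0#                                  ≈⟨ trans (+-identityʳ _) (zeroʳ _) ⟩
    0#                                             ∎

  infixl 7 _⋆_
  _⋆_ : (ℕ → Carrier) → (ℕ → Carrier) → ℕ → Carrier
  (f ⋆ g) zero    = f 0 * g 0
  (f ⋆ g) (suc k) = f 0 * g (suc k) + (f ∘ suc ⋆ g) k

  ⋆-cong : ∀ k {f f′ g g′ : ℕ → Carrier} → (∀ i → f i ≈ f′ i) → (∀ j → g j ≈ g′ j) → (f ⋆ g) k ≈ (f′ ⋆ g′) k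
  ⋆-cong zero    f≈f′ g≈g′ = *-cong (f≈f′ 0) (g≈g′ 0)
  ⋆-cong (suc k) f≈f′ g≈g′ = +-cong (*-cong (f≈f′ 0) (g≈g′ (suc k))) (⋆-cong k (f≈f′ ∘ suc) g≈g′)

  ⋆-unfoldʳ : ∀ k f g → (f ⋆ g) (suc k) ≈ (f ⋆ g ∘ suc) k + f (suc k) * g 0
  ⋆-unfoldʳ zero    f g = refl
  ⋆-unfoldʳ (suc k) f g = trans (+-congˡ (⋆-unfoldʳ k (f ∘ suc) g)) (sym (+-assoc _ _ _))

  ⋆-linearˡ : ∀ k f f′ g y → ((λ i → f i + y * f′ i) ⋆ g) k ≈ (f ⋆ g) k + y * (f′ ⋆ g) k
  ⋆-linearˡ zero f f′ g y =
    solve 4 (λ a b c d → (a :+ b :* c) :* d := a :* d :+ b :* (c :* d)) refl (f 0) y (f′ 0) (g 0)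
  ⋆-linearˡ (suc k) f f′ g y = trans (+-congˡ (⋆-linearˡ k (f ∘ suc) (f′ ∘ suc) g y))
    (solve 6 (λ a b c d p q → (a :+ b :* c) :* d :+ (p :+ b :* q) := (a :* d :+ p) :+ b :* (c :* d :+ q))
      refl (f 0) y (f′ 0) (g (suc k)) _ _)

  ⋆-linearʳ : ∀ k f g g′ y → (f ⋆ (λ j → g j + y * g′ j)) k ≈ (f ⋆ g) k + y * (f ⋆ g′) k
  ⋆-linearʳ zero f g g′ y =
    solve 4 (λ a b c d → d :* (a :+ b :* c) := d :* a :+ b :* (d :* c)) refl (g 0) y (g′ 0) (f 0)
  ⋆-linearʳ (suc k) f g g′ y = trans (+-congˡ (⋆-linearʳ k (f ∘ suc) g g′ y))
    (solve 6 (λ a b c d p q → d :* (a :+ b :* c) :+ (p :+ b :* q) := (d :* a :+ p) :+ b :* (d :* c :+ q))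
      refl (g (suc k)) y (g′ (suc k)) (f 0) _ _)

  ⋆-identityʳ : ∀ k f g → g 0 ≈ 1# → (∀ j → g (suc j) ≈ 0#) → (f ⋆ g) k ≈ f k
  ⋆-identityʳ zero    f g g₀≈1 g₊≈0 = trans (*-congˡ g₀≈1) (*-identityʳ _)
  ⋆-identityʳ (suc k) f g g₀≈1 g₊≈0 =
    trans (+-cong (trans (*-congˡ (g₊≈0 k)) (zeroʳ _)) (⋆-identityʳ k (f ∘ suc) g g₀≈1 g₊≈0)) (+-identityˡ _)

  -- multiplication of a power series by t
  shift : (ℕ → Carrier) → ℕ → Carrier
  shift f zero    = 0#
  shift f (suc i) = f i

  ⋆-shift : ∀ k f g → (shift f ⋆ g) k ≈ (f ⋆ shift g) k
  ⋆-shift zero    f g = trans (zeroˡ _) (sym (zeroʳ _))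
  ⋆-shift (suc k) f g = begin
    0# * g (suc k) + (f ⋆ g) k      ≈⟨ trans (+-congʳ (zeroˡ _)) (+-identityˡ _) ⟩
    (f ⋆ g) k                       ≈⟨ +-identityʳ _ ⟨
    (f ⋆ g) k + 0#                  ≈⟨ +-congˡ (zeroʳ _) ⟨
    (f ⋆ g) k + f (suc k) * 0#      ≈⟨ ⋆-unfoldʳ k f (shift g) ⟨
    (f ⋆ shift g) (suc k)           ∎

  -- (1 - y t) A times B / (1 - y t) is A B.
  ⋆-invariant : ∀ k (A A′ B B′ : ℕ → Carrier) y →
    A′ 0 ≈ A 0 → (∀ i → A′ (suc i) ≈ A (suc i) + (- y) * A i) →
    B′ 0 ≈ B 0 → (∀ j → B′ (suc j) ≈ B (suc j) + y * B′ j) →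
    (A′ ⋆ B′) k ≈ (A ⋆ B) k
  ⋆-invariant k A A′ B B′ y A′₀ A′₊ B′₀ B′₊ = begin
    (A′ ⋆ B′) k                                            ≈⟨ ⋆-cong k A′≈ (λ _ → refl) ⟩
    ((λ i → A i + (- y) * shift A i) ⋆ B′) k               ≈⟨ ⋆-linearˡ k A (shift A) B′ (- y) ⟩
    (A ⋆ B′) k + (- y) * (shift A ⋆ B′) k                  ≈⟨ +-cong (⋆-cong k (λ _ → refl) B′≈) (*-congˡ (⋆-shift k A B′)) ⟩
    (A ⋆ (λ j → B j + y * shift B′ j)) k + (- y) * (A ⋆ shift B′) k
                                                           ≈⟨ +-congʳ (⋆-linearʳ k A B (shift B′) y) ⟩
    ((A ⋆ B) k + y * (A ⋆ shift B′) k) + (- y) * (A ⋆ shift B′) k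
                                                           ≈⟨ +-assoc _ _ _ ⟩
    (A ⋆ B) k + (y * (A ⋆ shift B′) k + (- y) * (A ⋆ shift B′) k)
                                                           ≈⟨ +-congˡ (distribʳ _ y (- y)) ⟨
    (A ⋆ B) k + (y + - y) * (A ⋆ shift B′) k               ≈⟨ +-congˡ (trans (*-congʳ (-‿inverseʳ y)) (zeroˡ _)) ⟩
    (A ⋆ B) k + 0#                                         ≈⟨ +-identityʳ _ ⟩
    (A ⋆ B) k                                              ∎
    where
    A′≈ : ∀ i → A′ i ≈ A i + (- y) * shift A i
    A′≈ zero    = trans A′₀ (sym (trans (+-congˡ (zeroʳ _)) (+-identityʳ _)))
    A′≈ (suc i) = A′₊ i
    B′≈ : ∀ j → B′ j ≈ B j + y * shift B′ j
    B′≈ zero    = trans B′₀ (sym (trans (+-congˡ (zeroʳ _)) (+-identityʳ _)))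
    B′≈ (suc j) = B′₊ j

  Σ₁-cong-≤ : ∀ k {f g : ℕ → Carrier} → (∀ i → i ≤ k → f i ≈ g i) → Σ₁ k f ≈ Σ₁ k g
  Σ₁-cong-≤ zero    f≈g = refl
  Σ₁-cong-≤ (suc k) f≈g = +-cong (Σ₁-cong-≤ k (λ i i≤k → f≈g i (m≤n⇒m≤1+n i≤k))) (f≈g (suc k) ≤-refl)

  Σ₁-*ˡ : ∀ k x f → Σ₁ k (λ i → x * f i) ≈ x * Σ₁ k f
  Σ₁-*ˡ zero    x f = sym (zeroʳ x)
  Σ₁-*ˡ (suc k) x f = trans (+-congʳ (Σ₁-*ˡ k x f)) (sym (distribˡ x _ _))

  ⋆-Σ₁ : ∀ k f g → (f ⋆ g) k ≈ f 0 * g k + Σ₁ k (λ i → f i * g (k ∸ i))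
  ⋆-Σ₁ zero    f g = sym (+-identityʳ _)
  ⋆-Σ₁ (suc k) f g = begin
    (f ⋆ g) (suc k)
      ≈⟨ ⋆-unfoldʳ k f g ⟩
    (f ⋆ g ∘ suc) k + f (suc k) * g 0
      ≈⟨ +-congʳ (⋆-Σ₁ k f (g ∘ suc)) ⟩
    (f 0 * g (suc k) + Σ₁ k (λ i → f i * g (suc (k ∸ i)))) + f (suc k) * g 0
      ≈⟨ +-assoc _ _ _ ⟩
    f 0 * g (suc k) + (Σ₁ k (λ i → f i * g (suc (k ∸ i))) + f (suc k) * g 0)
      ≈⟨ +-congˡ (+-cong (Σ₁-cong-≤ k index-eq) top-eq) ⟩
    f 0 * g (suc k) + Σ₁ (suc k) (λ i → f i * g (suc k ∸ i)) ∎
    where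
    index-eq : ∀ i → i ≤ k → f i * g (suc (k ∸ i)) ≈ f i * g (suc k ∸ i)
    index-eq i i≤k = *-congˡ (reflexive (P.cong g (P.sym (+-∸-assoc 1 i≤k))))
    top-eq : f (suc k) * g 0 ≈ f (suc k) * g (suc k ∸ suc k)
    top-eq = *-congˡ (reflexive (P.cong g (P.sym (n∸n≡0 k))))

  signedE : (ℕ → Carrier) → ℕ → ℕ → Carrier
  signedE x n i = sgn i * e x i n

  completeH : (ℕ → Carrier) → ℕ → ℕ → Carrier
  completeH x m j = hₙ x j m

  signedE⋆completeH-peel : ∀ x k n m →
    (signedE x (suc n) ⋆ completeH x (suc m)) k ≈ (signedE (x ∘ suc) n ⋆ completeH (x ∘ suc) m) k
  signedE⋆completeH-peel x k n m =
    ⋆-invariant k (signedE (x ∘ suc) n) (signedE x (suc n)) (completeH (x ∘ suc) m) (completeH x (suc m))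
                (x 0) refl signedE-peel refl completeH-peel
    where
    signedE-peel : ∀ i → signedE x (suc n) (suc i) ≈ signedE (x ∘ suc) n (suc i) + (- x 0) * signedE (x ∘ suc) n i
    signedE-peel i = trans (*-congˡ (e-peel x i n))
      (trans (solve 5 (λ u s y p q → (u :* s) :* (y :* p :+ q) := (u :* s) :* q :+ (u :* y) :* (s :* p))
                refl (- 1#) (sgn i) (x 0) (e (x ∘ suc) i n) (e (x ∘ suc) (suc i) n))
             (+-congˡ (*-congʳ (-1*x≈-x (x 0)))))
    completeH-peel : ∀ j → completeH x (suc m) (suc j) ≈ completeH (x ∘ suc) m (suc j) + x 0 * completeH x (suc m) j
    completeH-peel j = trans (h-peel x j m) (+-comm _ _)

  signedE⋆completeH-vanish : ∀ x k m L → L < k → (signedE x (m ℕ.+ L) ⋆ completeH x m) k ≈ 0#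
  signedE⋆completeH-vanish x k zero L L<k = begin
    (signedE x L ⋆ completeH x 0) k  ≈⟨ ⋆-identityʳ k (signedE x L) (completeH x 0) (+-identityʳ _) (λ _ → refl) ⟩
    sgn k * e x k L                   ≈⟨ *-congˡ (e-vanish x L k L<k) ⟩
    sgn k * 0#                        ≈⟨ zeroʳ _ ⟩
    0#                                ∎
  signedE⋆completeH-vanish x k (suc m) L L<k =
    trans (signedE⋆completeH-peel x k (m ℕ.+ L) m) (signedE⋆completeH-vanish (x ∘ suc) k m L L<k)

  hₙ-recurrence : ∀ x k m L → L < k →
    hₙ x k m ≈ Σ₁ k (λ i → sgn (suc i) * (e x i (m ℕ.+ L) * hₙ x (k ∸ i) m))
  hₙ-recurrence x k m L L<k = begin
    hₙ x k m                                     ≈⟨ inverseˡ-unique _ _ sum≈0 ⟩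
    - W                                          ≈⟨ -1*x≈-x W ⟨
    - 1# * W                                     ≈⟨ Σ₁-*ˡ k (- 1#) _ ⟨
    Σ₁ k (λ i → - 1# * (signedE x n i * completeH x m (k ∸ i)))
      ≈⟨ Σ₁-cong-≤ k (λ i _ → solve 4 (λ u s p q → u :* (s :* p :* q) := u :* s :* (p :* q))
                                       refl (- 1#) (sgn i) (e x i n) (hₙ x (k ∸ i) m)) ⟩
    Σ₁ k (λ i → sgn (suc i) * (e x i n * hₙ x (k ∸ i) m)) ∎
    where
    n = m ℕ.+ L
    W = Σ₁ k (λ i → signedE x n i * completeH x m (k ∸ i))
    sum≈0 : hₙ x k m + W ≈ 0#
    sum≈0 = begin
      hₙ x k m + W                                ≈⟨ +-congʳ (trans (*-congʳ (trans (*-identityˡ _) (+-identityʳ _)))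
                                                                      (*-identityˡ _)) ⟨
      signedE x n 0 * completeH x m k + W         ≈⟨ ⋆-Σ₁ k (signedE x n) (completeH x m) ⟨
      (signedE x n ⋆ completeH x m) k             ≈⟨ signedE⋆completeH-vanish x k m L L<k ⟩
      0#                                          ∎

  h-⊖ : ∀ x j n k → h x j (n ⊖ k) ≈ hₙ x j (n ∸ k)
  h-⊖ x j       n       zero    = refl
  h-⊖ x zero    zero    (suc k) = sym (+-identityʳ _)
  h-⊖ x (suc j) zero    (suc k) = refl
  h-⊖ x j       (suc n) (suc k) rewrite [1+m]⊖[1+n]≡m⊖n n k = h-⊖ x j n k

  h-recurrence : ∀ x k n →
    h x (suc k) (n ⊖ k) ≈ Σ₁ (suc k) (λ i → sgn (suc i) * (e x i n * h x (suc k ∸ i) (n ⊖ k)))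
  h-recurrence x k n = begin
    h x (suc k) (n ⊖ k)
      ≈⟨ h-⊖ x (suc k) n k ⟩
    hₙ x (suc k) m
      ≈⟨ P.subst (λ n′ → hₙ x (suc k) m ≈ rhs n′) m+L≡n (hₙ-recurrence x (suc k) m L L<1+k) ⟩
    rhs n
      ≈⟨ Σ₁-cong-≤ (suc k) (λ i _ → *-congˡ (*-congˡ (sym (h-⊖ x (suc k ∸ i) n k)))) ⟩
    Σ₁ (suc k) (λ i → sgn (suc i) * (e x i n * h x (suc k ∸ i) (n ⊖ k))) ∎
    where
    m = n ∸ k
    L = k ⊓ n
    L<1+k : L < suc k
    L<1+k = s≤s (m⊓n≤m k n)
    m+L≡n : m ℕ.+ L ≡ n
    m+L≡n = P.trans (ℕₚ.+-comm m L) (m⊓n+n∸m≡n k n)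
    rhs : ℕ → Carrier
    rhs n′ = Σ₁ (suc k) (λ i → sgn (suc i) * (e x i n′ * hₙ x (suc k ∸ i) m))

proposition1 : ∀ {c ℓ : Level} (R : CommutativeRing c ℓ) (k n : ℕ) → k ≥ 1 → n ≥ 1 →
    (x : ℕ → CommutativeRing.Carrier R) →
    let open Sym R in
    h x k ((+ n ℤ.- + k) ℤ.+ + 1)
      ≈ Σ₁ k (λ i → sgn (suc i) * (e x i n * h x (k ∸ i) ((+ n ℤ.- + k) ℤ.+ + 1)))
proposition1 R (suc k) n _ _ x rewrite n-[1+k]+1≡n⊖k n k = SymmetricFunctions.h-recurrence R x k n
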